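{- Let $r(x)=\sum_{n\ge 0}x^{2^n-1}$, $B(x)=1-xr(x)$, $h_n=H_n(B(x))$, and $g_n=H_n\!\left(\frac{1-r(x)}{x}\right)$. Then $h_0=h_1=1$, $h_2=-2$, and for each $n\ge 3$, $$h_n=(-1)^n\,(h_m+g_{m-1}),$$ where $k$ is the integer with $2^k<n\le 2^{k+1}$ and $m=2^{k+1}-n+1$.
   Context: For a power series $f(x)=\sum_{i\ge 0}a_ix^i$ and $n\ge 1$, $H_n(f)=\det(a_{i+j})_{0\le i,j\le n-1}$, $H_0(f)=1$. -}

module Defs where

open import Data.Nat as ℕ using (ℕ; zero; suc; _≡ᵇ_)
open import Data.Bool using (Bool; true; false; if_then_else_)
open import Data.List using (List; upTo)
open import Data.Bool.ListAction using (any)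
open import Data.Fin using (Fin; zero; suc; toℕ; punchIn)
open import Data.Integer using (ℤ; +_; -_; _+_; _*_; _^_)

sumFin : (n : ℕ) → (Fin n → ℤ) → ℤ
sumFin zero    f = + 0
sumFin (suc n) f = f zero + sumFin n (λ i → f (suc i))

det : (n : ℕ) → (Fin n → Fin n → ℤ) → ℤ
det zero    M = + 1
det (suc n) M = sumFin (suc n) λ j →
  ((- + 1) ^ toℕ j) * (M zero j * det n (λ i k → M (suc i) (punchIn j k)))

-- Hankel determinant H_n(f) of the power series with coefficient sequence a
-- (H_0 = 1 since det of the empty matrix is 1)
H : ℕ → (ℕ → ℤ) → ℤ
H n a = det n (λ i j → a (toℕ i ℕ.+ toℕ j))

-- i = 2^e - 1 for some e  (decided by checking e ≤ i+1; note 2^e - 1 ≥ e)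
isPow2m1 : ℕ → Bool
isPow2m1 i = any (λ e → (2 ℕ.^ e) ≡ᵇ suc i) (upTo (suc (suc i)))

rCoef : ℕ → ℤ
rCoef i = if isPow2m1 i then + 1 else + 0

-- coefficients of B(x) = 1 - x r(x)
BCoef : ℕ → ℤ
BCoef zero    = + 1
BCoef (suc i) = - rCoef i

-- coefficients of (1 - r(x)) / x  (constant term of 1 - r(x) is 0)
GCoef : ℕ → ℤ
GCoef j = - rCoef (suc j)

h : ℕ → ℤ
h n = H n BCoef

g : ℕ → ℤ
g n = H n GCoef

{-# OPTIONS --safe #-}
-- B has coefficient 1 at 0, −1 at the powers of two and 0 elsewhere. Let 2^k < n ≤ 2^(k+1),
-- m = 2^(k+1) − n + 1 and t = n − 2^k − 1, so that m + t = 2^k and n = 2t + m + 1.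
-- In (B (i + j)) for 0 ≤ i, j < n the last row and column meet the antidiagonal i + j = 2^(k+1)
-- only at position m; all their other entries lie strictly between consecutive powers of two.
-- Expanding along that column and then that row costs a factor −1 and deletes the indices m and
-- n − 1; the remaining index set 0, …, m − 1 followed by a block whose extreme indices again sum to
-- 2^(k+1) has the same shape. After t steps the indices are 0, …, m − 1, 2^k, the last row is
-- (−1, 0, …, 0, −1), and linearity in that row gives −(h_m + g_(m−1)). Finally
-- (−1)^n = −(−1)^t because m + t is even.
module Submission where

module Sign where

  open import Data.Nat as ℕ using (ℕ; zero; suc)
  open import Data.Integer using (ℤ; +_; -_; _*_; _^_)
  open import Data.Integer.Properties using (*-identityˡ; *-identityʳ; *-assoc; ^-distribˡ-+-*)
  open import Data.Integer.Tactic.RingSolver using (solve-∀)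
  open import Relation.Binary.PropositionalEquality
  open ≡-Reasoning

  -1^_ : ℕ → ℤ
  -1^ k = (- + 1) ^ k

  -1^-square : ∀ k → -1^ k * -1^ k ≡ + 1
  -1^-square zero    = refl
  -1^-square (suc k) = trans (signs-cancel (-1^ k)) (-1^-square k)
    where
    signs-cancel : ∀ a → (- + 1 * a) * (- + 1 * a) ≡ a * a
    signs-cancel = solve-∀

  -1^-double : ∀ k → -1^ (k ℕ.+ k) ≡ + 1
  -1^-double k = trans (^-distribˡ-+-* (- + 1) k k) (-1^-square k)

  -1^-even : ∀ k → -1^ (k ℕ.* 2) ≡ + 1
  -1^-even zero    = refl
  -1^-even (suc k) = cong (λ x → - + 1 * (- + 1 * x)) (-1^-even k)

  -1^-same-parity : ∀ a b k → a ℕ.+ b ≡ k ℕ.* 2 → -1^ a ≡ -1^ b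
  -1^-same-parity a b k a+b≡2k = begin
    -1^ a                     ≡⟨ *-identityʳ (-1^ a) ⟨
    -1^ a * + 1               ≡⟨ cong (-1^ a *_) (-1^-square b) ⟨
    -1^ a * (-1^ b * -1^ b)   ≡⟨ *-assoc (-1^ a) (-1^ b) (-1^ b) ⟨
    -1^ a * -1^ b * -1^ b     ≡⟨ cong (_* -1^ b) (^-distribˡ-+-* (- + 1) a b) ⟨
    -1^ (a ℕ.+ b) * -1^ b     ≡⟨ cong (λ x → -1^ x * -1^ b) a+b≡2k ⟩
    -1^ (k ℕ.* 2) * -1^ b     ≡⟨ cong (_* -1^ b) (-1^-even k) ⟩
    + 1 * -1^ b               ≡⟨ *-identityˡ (-1^ b) ⟩
    -1^ b                     ∎

  -1^-suc-cancel : ∀ k x y z → -1^ (suc k) * x * (-1^ k * y * z) ≡ - (x * y * z)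
  -1^-suc-cancel k x y z = begin
    - + 1 * s * x * (s * y * z)  ≡⟨ regroup s x y z ⟩
    - (s * s * (x * y * z))      ≡⟨ cong (λ t → - (t * (x * y * z))) (-1^-square k) ⟩
    - (+ 1 * (x * y * z))        ≡⟨ cong -_ (*-identityˡ (x * y * z)) ⟩
    - (x * y * z)                ∎
    where
    s = -1^ k
    regroup : ∀ s x y z → - + 1 * s * x * (s * y * z) ≡ - (s * s * (x * y * z))
    regroup = solve-∀

module Determinant where

  open Sign

  open import Defs
  open import Data.Nat as ℕ using (ℕ; zero; suc)
  open import Data.Fin using (Fin; zero; suc; toℕ; punchIn)
  open import Data.Integer using (ℤ; +_; -_; _+_; _*_)
  open import Data.Integer.Properties
    using (+-*-semiring; +-identityˡ; +-identityʳ; *-zeroʳ; *-assoc; ^-distribˡ-+-*)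
  open import Data.Integer.Tactic.RingSolver using (solve-∀)
  open import Algebra.Properties.Semiring.Sum +-*-semiring
    using (sum; sum-cong-≗; sum-remove; sum-replicate-zero; ∑-distrib-+; *-distribˡ-sum)
  open import Data.Product using (_×_; _,_)
  open import Function using (_∘_; const)
  open import Data.Vec.Functional using (updateAt)
  open import Data.Vec.Functional.Properties using (updateAt-updates; updateAt-minimal)
  open import Data.Fin.Properties using (punchInᵢ≢i)
  open import Relation.Binary.PropositionalEquality
  open ≡-Reasoning

  Mat : ℕ → Set
  Mat n = Fin n → Fin n → ℤ

  minor : ∀ {n} → Mat (suc n) → Fin (suc n) → Fin (suc n) → Mat n
  minor M r c i k = M (punchIn r i) (punchIn c k)

  sumFin≡sum : ∀ n (f : Fin n → ℤ) → sumFin n f ≡ sum f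
  sumFin≡sum zero    f = refl
  sumFin≡sum (suc n) f = cong (_+_ (f zero)) (sumFin≡sum n (f ∘ suc))

  sum-zero : ∀ n {f : Fin n → ℤ} → (∀ i → f i ≡ + 0) → sum f ≡ + 0
  sum-zero n f≗0 = trans (sum-cong-≗ f≗0) (sum-replicate-zero n)

  expansionTerm : ∀ {n} → Mat (suc n) → Fin (suc n) → ℤ
  expansionTerm {n} M j = -1^ toℕ j * (M zero j * det n (minor M zero j))

  det-suc : ∀ n (M : Mat (suc n)) → det (suc n) M ≡ sum (expansionTerm M)
  det-suc n M = sumFin≡sum (suc n) (expansionTerm M)

  det-cong : ∀ n {M N : Mat n} → (∀ i j → M i j ≡ N i j) → det n M ≡ det n N
  det-cong zero    M≈N = refl
  det-cong (suc n) {M} {N} M≈N = begin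
    det (suc n) M            ≡⟨ det-suc n M ⟩
    sum (expansionTerm M)    ≡⟨ sum-cong-≗ term≈ ⟩
    sum (expansionTerm N)    ≡⟨ det-suc n N ⟨
    det (suc n) N            ∎
    where
    term≈ : ∀ j → expansionTerm M j ≡ expansionTerm N j
    term≈ j = cong₂ (λ x y → -1^ toℕ j * (x * y))
      (M≈N zero j) (det-cong n (λ i k → M≈N (suc i) (punchIn j k)))

  -- relocate c j is the position of column c once column punchIn c j has been deleted.
  relocate : ∀ {n} → Fin (suc (suc n)) → Fin (suc n) → Fin (suc n)
  relocate zero            j       = zero
  relocate (suc c)         zero    = c
  relocate {suc n} (suc c) (suc j) = suc (relocate c j)

  punchIn-relocate : ∀ {n} (c : Fin (suc (suc n))) j → punchIn (punchIn c j) (relocate c j) ≡ c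
  punchIn-relocate zero            j       = refl
  punchIn-relocate (suc c)         zero    = refl
  punchIn-relocate {suc n} (suc c) (suc j) = cong suc (punchIn-relocate c j)

  punchIn-punchIn-relocate : ∀ {n} (c : Fin (suc (suc n))) j (k : Fin n) →
    punchIn (punchIn c j) (punchIn (relocate c j) k) ≡ punchIn c (punchIn j k)
  punchIn-punchIn-relocate zero            j       k       = refl
  punchIn-punchIn-relocate (suc c)         zero    k       = refl
  punchIn-punchIn-relocate {suc n} (suc c) (suc j) zero    = refl
  punchIn-punchIn-relocate {suc n} (suc c) (suc j) (suc k) = cong suc (punchIn-punchIn-relocate c j k)

  -1^-relocate : ∀ {n} (c : Fin (suc (suc n))) j →
    -1^ toℕ (punchIn c j) * -1^ toℕ (relocate c j) ≡ - (-1^ toℕ c * -1^ toℕ j)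
  -1^-relocate zero            j       = neg-head (-1^ toℕ j)
    where
    neg-head : ∀ a → ((- + 1) * a) * + 1 ≡ - (+ 1 * a)
    neg-head = solve-∀
  -1^-relocate (suc c)         zero    = neg-tail (-1^ toℕ c)
    where
    neg-tail : ∀ a → + 1 * a ≡ - (((- + 1) * a) * + 1)
    neg-tail = solve-∀
  -1^-relocate {suc n} (suc c) (suc j) = begin
    (- + 1 * x) * (- + 1 * y)  ≡⟨ signs-cancel x y ⟩
    x * y                      ≡⟨ -1^-relocate c j ⟩
    - (z * w)                  ≡⟨ cong -_ (signs-cancel z w) ⟨
    - ((- + 1 * z) * (- + 1 * w)) ∎
    where
    x = -1^ toℕ (punchIn c j)
    y = -1^ toℕ (relocate c j)
    z = -1^ toℕ c
    w = -1^ toℕ j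
    signs-cancel : ∀ a b → (- + 1 * a) * (- + 1 * b) ≡ a * b
    signs-cancel = solve-∀

  ExpandsAt : ∀ {n} → Mat (suc n) → Fin (suc n) → Fin (suc n) → Set
  ExpandsAt {n} M r c = det (suc n) M ≡ -1^ (toℕ r ℕ.+ toℕ c) * M r c * det n (minor M r c)

  expandsAt-zero : ∀ {n} (M : Mat (suc n)) r c → ExpandsAt M r c → M r c ≡ + 0 → det (suc n) M ≡ + 0
  expandsAt-zero {n} M r c expands Mrc≡0 = begin
    det (suc n) M                                           ≡⟨ expands ⟩
    -1^ (toℕ r ℕ.+ toℕ c) * M r c * det n (minor M r c)    ≡⟨ cong (λ x → -1^ (toℕ r ℕ.+ toℕ c) * x * det n (minor M r c)) Mrc≡0 ⟩
    -1^ (toℕ r ℕ.+ toℕ c) * + 0 * det n (minor M r c)      ≡⟨ cong (_* det n (minor M r c)) (*-zeroʳ (-1^ (toℕ r ℕ.+ toℕ c))) ⟩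
    + 0                                                     ∎

  expansionTerm-zero-entry : ∀ {n} (M : Mat (suc n)) j → M zero j ≡ + 0 → expansionTerm M j ≡ + 0
  expansionTerm-zero-entry {n} M j Mj≡0 =
    trans (cong (λ x → -1^ toℕ j * (x * det n (minor M zero j))) Mj≡0) (*-zeroʳ (-1^ toℕ j))

  expansionTerm-zero-minor : ∀ {n} (M : Mat (suc n)) j → det n (minor M zero j) ≡ + 0 → expansionTerm M j ≡ + 0
  expansionTerm-zero-minor M j det≡0 =
    trans (cong (λ x → -1^ toℕ j * (M zero j * x)) det≡0)
          (trans (cong (-1^ toℕ j *_) (*-zeroʳ (M zero j))) (*-zeroʳ (-1^ toℕ j)))

  expandsAt-first-row : ∀ n (M : Mat (suc n)) c →
    (∀ j → expansionTerm M (punchIn c j) ≡ + 0) → ExpandsAt M zero c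
  expandsAt-first-row n M c others = begin
    det (suc n) M                                          ≡⟨ det-suc n M ⟩
    sum (expansionTerm M)                                  ≡⟨ sum-remove {i = c} (expansionTerm M) ⟩
    expansionTerm M c + sum (expansionTerm M ∘ punchIn c)  ≡⟨ cong (_+_ (expansionTerm M c)) (sum-zero n others) ⟩
    expansionTerm M c + + 0                                ≡⟨ +-identityʳ _ ⟩
    expansionTerm M c                                      ≡⟨ *-assoc (-1^ toℕ c) (M zero c) _ ⟨
    -1^ toℕ c * M zero c * det n (minor M zero c)          ∎

  -- Expand along row 0 and each minor along row r: all terms but the c-th share the sign and entry of position (suc r, c).
  expandsAt-suc : ∀ n (M : Mat (suc (suc n))) r c →
    expansionTerm M c ≡ + 0 →
    (∀ j → ExpandsAt (minor M zero (punchIn c j)) r (relocate c j)) →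
    ExpandsAt M (suc r) c
  expandsAt-suc n M r c term≡0 minors = begin
    det (suc (suc n)) M                                    ≡⟨ det-suc (suc n) M ⟩
    sum (expansionTerm M)                                  ≡⟨ sum-remove {i = c} (expansionTerm M) ⟩
    expansionTerm M c + sum (expansionTerm M ∘ punchIn c)  ≡⟨ cong₂ _+_ term≡0 (sum-cong-≗ factor) ⟩
    + 0 + sum (λ j → s * expansionTerm N j)                ≡⟨ +-identityˡ _ ⟩
    sum (λ j → s * expansionTerm N j)                      ≡⟨ *-distribˡ-sum s (expansionTerm N) ⟨
    s * sum (expansionTerm N)                              ≡⟨ cong (s *_) (det-suc n N) ⟨
    s * det (suc n) N                                      ∎
    where
    s = -1^ (suc (toℕ r) ℕ.+ toℕ c) * M (suc r) c
    N = minor M (suc r) c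
    regroup : ∀ X Y R C J A E D → X * Y ≡ - (C * J) →
      X * (A * (R * Y * E * D)) ≡ - + 1 * (R * C) * E * (J * (A * D))
    regroup X Y R C J A E D XY≡-CJ = begin
      X * (A * (R * Y * E * D))    ≡⟨ pull-out X Y R A E D ⟩
      X * Y * (R * A * E * D)      ≡⟨ cong (_* (R * A * E * D)) XY≡-CJ ⟩
      - (C * J) * (R * A * E * D)  ≡⟨ push-in C J R A E D ⟩
      - + 1 * (R * C) * E * (J * (A * D)) ∎
      where
      pull-out : ∀ X Y R A E D → X * (A * (R * Y * E * D)) ≡ X * Y * (R * A * E * D)
      pull-out = solve-∀
      push-in : ∀ C J R A E D → - (C * J) * (R * A * E * D) ≡ - + 1 * (R * C) * E * (J * (A * D))
      push-in = solve-∀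
    factor : ∀ j → expansionTerm M (punchIn c j) ≡ s * expansionTerm N j
    factor j = begin
      X * (A * det (suc n) (minor M zero c′))
        ≡⟨ cong (λ x → X * (A * x)) (minors j) ⟩
      X * (A * (-1^ (toℕ r ℕ.+ toℕ w) * M (suc r) (punchIn c′ w) * det n (minor (minor M zero c′) r w)))
        ≡⟨ cong₂ (λ x y → X * (A * (-1^ (toℕ r ℕ.+ toℕ w) * M (suc r) x * y)))
                 (punchIn-relocate c j)
                 (det-cong n (λ i k → cong (M (suc (punchIn r i))) (punchIn-punchIn-relocate c j k))) ⟩
      X * (A * (-1^ (toℕ r ℕ.+ toℕ w) * M (suc r) c * D))
        ≡⟨ cong (λ x → X * (A * (x * M (suc r) c * D))) (^-distribˡ-+-* (- + 1) (toℕ r) (toℕ w)) ⟩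
      X * (A * (-1^ toℕ r * -1^ toℕ w * M (suc r) c * D))
        ≡⟨ regroup X (-1^ toℕ w) (-1^ toℕ r) (-1^ toℕ c) (-1^ toℕ j) A (M (suc r) c) D (-1^-relocate c j) ⟩
      - + 1 * (-1^ toℕ r * -1^ toℕ c) * M (suc r) c * (-1^ toℕ j * (A * D))
        ≡⟨ cong (λ x → - + 1 * x * M (suc r) c * (-1^ toℕ j * (A * D))) (^-distribˡ-+-* (- + 1) (toℕ r) (toℕ c)) ⟨
      s * expansionTerm N j ∎
      where
      c′ = punchIn c j
      w = relocate c j
      X = -1^ toℕ c′
      A = M zero c′
      D = det n (minor N zero j)

  det-expand-row : ∀ n (M : Mat (suc n)) r c → (∀ j → M r (punchIn c j) ≡ + 0) → ExpandsAt M r c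
  det-expand-row n M zero c row≡0 =
    expandsAt-first-row n M c (λ j → expansionTerm-zero-entry M (punchIn c j) (row≡0 j))
  det-expand-row (suc n) M (suc r) c row≡0 = expandsAt-suc n M r c term-c minors
    where
    term-c : expansionTerm M c ≡ + 0
    term-c = expansionTerm-zero-minor M c
      (expandsAt-zero (minor M zero c) r zero (det-expand-row n (minor M zero c) r zero (row≡0 ∘ suc)) (row≡0 zero))
    minors : ∀ j → ExpandsAt (minor M zero (punchIn c j)) r (relocate c j)
    minors j = det-expand-row n (minor M zero (punchIn c j)) r (relocate c j)
      (λ k → trans (cong (M (suc r)) (punchIn-punchIn-relocate c j k)) (row≡0 (punchIn j k)))

  det-expand-col : ∀ n (M : Mat (suc n)) r c → (∀ i → M (punchIn r i) c ≡ + 0) → ExpandsAt M r c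
  det-expand-col zero M zero c _ = expandsAt-first-row zero M c (λ ())
  det-expand-col (suc n) M zero c col≡0 = expandsAt-first-row (suc n) M c others
    where
    others : ∀ j → expansionTerm M (punchIn c j) ≡ + 0
    others j = expansionTerm-zero-minor M (punchIn c j)
      (expandsAt-zero (minor M zero (punchIn c j)) zero (relocate c j)
        (det-expand-col n (minor M zero (punchIn c j)) zero (relocate c j) (col-entry ∘ suc)) (col-entry zero))
      where
      col-entry : ∀ i → minor M zero (punchIn c j) i (relocate c j) ≡ + 0
      col-entry i = trans (cong (M (suc i)) (punchIn-relocate c j)) (col≡0 i)
  det-expand-col (suc n) M (suc r) c col≡0 =
    expandsAt-suc n M r c (expansionTerm-zero-entry M c (col≡0 zero)) minors
    where
    minors : ∀ j → ExpandsAt (minor M zero (punchIn c j)) r (relocate c j)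
    minors j = det-expand-col n (minor M zero (punchIn c j)) r (relocate c j)
      (λ i → trans (cong (M (suc (punchIn r i))) (punchIn-relocate c j)) (col≡0 (suc i)))

  RowSplit : ∀ {n} → Mat (suc n) → Mat (suc n) → Mat (suc n) → Fin (suc n) → Set
  RowSplit M M₁ M₂ r = (∀ j → M r j ≡ M₁ r j + M₂ r j)
                     × (∀ i j → M₁ (punchIn r i) j ≡ M (punchIn r i) j)
                     × (∀ i j → M₂ (punchIn r i) j ≡ M (punchIn r i) j)

  det-linear-row : ∀ n (M M₁ M₂ : Mat (suc n)) r → RowSplit M M₁ M₂ r →
    det (suc n) M ≡ det (suc n) M₁ + det (suc n) M₂
  expansionTerm-linear-row : ∀ n (M M₁ M₂ : Mat (suc n)) r → RowSplit M M₁ M₂ r →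
    ∀ j → expansionTerm M j ≡ expansionTerm M₁ j + expansionTerm M₂ j

  det-linear-row n M M₁ M₂ r split = begin
    det (suc n) M                                          ≡⟨ det-suc n M ⟩
    sum (expansionTerm M)                                  ≡⟨ sum-cong-≗ (expansionTerm-linear-row n M M₁ M₂ r split) ⟩
    sum (λ j → expansionTerm M₁ j + expansionTerm M₂ j)    ≡⟨ ∑-distrib-+ (expansionTerm M₁) (expansionTerm M₂) ⟩
    sum (expansionTerm M₁) + sum (expansionTerm M₂)        ≡⟨ cong₂ _+_ (det-suc n M₁) (det-suc n M₂) ⟨
    det (suc n) M₁ + det (suc n) M₂                        ∎

  expansionTerm-linear-row n M M₁ M₂ zero (row-sum , rest₁ , rest₂) j = begin
    s * (M zero j * D)                         ≡⟨ cong (λ x → s * (x * D)) (row-sum j) ⟩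
    s * ((M₁ zero j + M₂ zero j) * D)          ≡⟨ distribute s (M₁ zero j) (M₂ zero j) D ⟩
    s * (M₁ zero j * D) + s * (M₂ zero j * D)
      ≡⟨ cong₂ (λ x y → s * (M₁ zero j * x) + s * (M₂ zero j * y))
               (det-cong n (λ i k → sym (rest₁ i (punchIn j k))))
               (det-cong n (λ i k → sym (rest₂ i (punchIn j k)))) ⟩
    expansionTerm M₁ j + expansionTerm M₂ j    ∎
    where
    s = -1^ toℕ j
    D = det n (minor M zero j)
    distribute : ∀ s a b d → s * ((a + b) * d) ≡ s * (a * d) + s * (b * d)
    distribute = solve-∀
  expansionTerm-linear-row (suc n) M M₁ M₂ (suc r) (row-sum , rest₁ , rest₂) j = begin
    s * (M zero j * det (suc n) (minor M zero j))
      ≡⟨ cong (λ x → s * (M zero j * x)) (det-linear-row n (minor M zero j) (minor M₁ zero j) (minor M₂ zero j) r split) ⟩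
    s * (M zero j * (D₁ + D₂))                  ≡⟨ distribute s (M zero j) D₁ D₂ ⟩
    s * (M zero j * D₁) + s * (M zero j * D₂)   ≡⟨ cong₂ (λ x y → s * (x * D₁) + s * (y * D₂)) (sym (rest₁ zero j)) (sym (rest₂ zero j)) ⟩
    expansionTerm M₁ j + expansionTerm M₂ j     ∎
    where
    s = -1^ toℕ j
    D₁ = det (suc n) (minor M₁ zero j)
    D₂ = det (suc n) (minor M₂ zero j)
    split : RowSplit (minor M zero j) (minor M₁ zero j) (minor M₂ zero j) r
    split = (λ k → row-sum (punchIn j k)) , (λ i k → rest₁ (suc i) (punchIn j k)) , (λ i k → rest₂ (suc i) (punchIn j k))
    distribute : ∀ s a d₁ d₂ → s * (a * (d₁ + d₂)) ≡ s * (a * d₁) + s * (a * d₂)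
    distribute = solve-∀

  det-minor-updateAt : ∀ n (M : Mat (suc n)) r f c → det n (minor (updateAt M r f) r c) ≡ det n (minor M r c)
  det-minor-updateAt n M r f c = det-cong n λ i k →
    cong (λ row → row (punchIn c k)) (updateAt-minimal (punchIn r i) r M (punchInᵢ≢i r i))

  det-updateAt-row-+ : ∀ n (M : Mat (suc n)) r (u v : Fin (suc n) → ℤ) → (∀ j → M r j ≡ u j + v j) →
    det (suc n) M ≡ det (suc n) (updateAt M r (const u)) + det (suc n) (updateAt M r (const v))
  det-updateAt-row-+ n M r u v row-sum =
    det-linear-row n M (updateAt M r (const u)) (updateAt M r (const v)) r
      ( (λ j → trans (row-sum j) (sym (cong₂ (λ x y → x j + y j) (updateAt-updates r M) (updateAt-updates r M))))
      , untouched (const u) , untouched (const v) )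
    where
    untouched : ∀ f i j → updateAt M r f (punchIn r i) j ≡ M (punchIn r i) j
    untouched f i j = cong (λ row → row j) (updateAt-minimal (punchIn r i) r M (punchInᵢ≢i r i))

module Indexing where

  open import Data.Nat using (ℕ; zero; suc; _+_; _≤_; _<_; z≤n; s≤s)
  open import Data.Nat.Properties using (≤-refl; +-suc; +-identityʳ; +-cancelʳ-≡; suc-injective)
  open import Data.Fin using (Fin; zero; suc; toℕ; punchIn)
  open import Relation.Binary.PropositionalEquality

  skip : ℕ → ℕ → ℕ
  skip zero    i       = suc i
  skip (suc r) zero    = zero
  skip (suc r) (suc i) = suc (skip r i)

  toℕ-punchIn : ∀ {n} (r : Fin (suc n)) (i : Fin n) → toℕ (punchIn r i) ≡ skip (toℕ r) (toℕ i)
  toℕ-punchIn zero    i       = refl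
  toℕ-punchIn (suc r) zero    = refl
  toℕ-punchIn (suc r) (suc i) = cong suc (toℕ-punchIn r i)

  skip-< : ∀ {r i} → i < r → skip r i ≡ i
  skip-< {suc r} {zero}  _         = refl
  skip-< {suc r} {suc i} (s≤s i<r) = cong suc (skip-< i<r)

  skip-≥ : ∀ {r i} → r ≤ i → skip r i ≡ suc i
  skip-≥ {zero}  {i}     _         = refl
  skip-≥ {suc r} {suc i} (s≤s r≤i) = cong suc (skip-≥ r≤i)

  skip-≤ : ∀ r i → skip r i ≤ suc i
  skip-≤ zero    i       = ≤-refl
  skip-≤ (suc r) zero    = z≤n
  skip-≤ (suc r) (suc i) = s≤s (skip-≤ r i)

  skip-≢ : ∀ r i → skip r i ≢ r
  skip-≢ zero    i       ()
  skip-≢ (suc r) zero    ()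
  skip-≢ (suc r) (suc i) eq = skip-≢ r i (suc-injective eq)

  -- skipBlock m l enumerates ℕ without m, …, m + l − 1, in increasing order.
  skipBlock : ℕ → ℕ → ℕ → ℕ
  skipBlock zero    l i       = i + l
  skipBlock (suc m) l zero    = zero
  skipBlock (suc m) l (suc i) = suc (skipBlock m l i)

  skipBlock-< : ∀ {m} l {i} → i < m → skipBlock m l i ≡ i
  skipBlock-< {suc m} l {zero}  _         = refl
  skipBlock-< {suc m} l {suc i} (s≤s i<m) = cong suc (skipBlock-< l i<m)

  skipBlock-≥ : ∀ {m} l {i} → m ≤ i → skipBlock m l i ≡ i + l
  skipBlock-≥ {zero}  l {i}     _         = refl
  skipBlock-≥ {suc m} l {suc i} (s≤s m≤i) = cong suc (skipBlock-≥ l m≤i)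

  skipBlock-≤ : ∀ m l i → skipBlock m l i ≤ i + l
  skipBlock-≤ zero    l i       = ≤-refl
  skipBlock-≤ (suc m) l zero    = z≤n
  skipBlock-≤ (suc m) l (suc i) = s≤s (skipBlock-≤ m l i)

  skipBlock-injective : ∀ m l {i j} → skipBlock m l i ≡ skipBlock m l j → i ≡ j
  skipBlock-injective zero    l {i} {j} eq = +-cancelʳ-≡ l i j eq
  skipBlock-injective (suc m) l {zero}  {zero}  eq = refl
  skipBlock-injective (suc m) l {suc i} {suc j} eq = cong suc (skipBlock-injective m l (suc-injective eq))

  skipBlock-zero : ∀ m i → skipBlock m 0 i ≡ i
  skipBlock-zero zero    i       = +-identityʳ i
  skipBlock-zero (suc m) zero    = refl
  skipBlock-zero (suc m) (suc i) = cong suc (skipBlock-zero m i)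

  skipBlock-skip : ∀ m l i → skipBlock m l (skip m i) ≡ skipBlock m (suc l) i
  skipBlock-skip zero    l i       = sym (+-suc i l)
  skipBlock-skip (suc m) l zero    = refl
  skipBlock-skip (suc m) l (suc i) = cong suc (skipBlock-skip m l i)

module PowersOfTwo where

  open import Defs
  open import Data.Nat using (_≡ᵇ_; zero; suc; _+_; _*_; _^_; _≤_; _<_; z≤n; s≤s; _≤?_)
  open import Data.Nat.Properties
  open import Data.List using (upTo)
  open import Data.Bool using (true; false; T)
  open import Data.Integer using (+_; -_)
  open import Data.List.Relation.Unary.Any.Properties using (any⁺; any⁻; applyUpTo⁺; applyUpTo⁻)
  open import Data.Product using (∃; _,_)
  open import Data.Empty using (⊥; ⊥-elim)
  open import Function using (id)
  open import Relation.Binary.PropositionalEquality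
  open import Relation.Nullary using (yes; no)
  open import Relation.Binary using (tri<; tri≈; tri>)

  n<2^n : ∀ n → n < 2 ^ n
  n<2^n zero    = s≤s z≤n
  n<2^n (suc n) = begin-strict
    suc n             ≤⟨ n<2^n n ⟩
    2 ^ n             <⟨ m<m+n (2 ^ n) (m^n>0 2 n) ⟩
    2 ^ n + 2 ^ n     ≡⟨ cong (_+_ (2 ^ n)) (+-identityʳ (2 ^ n)) ⟨
    2 ^ suc n         ∎
    where open ≤-Reasoning

  isPow2m1-complete : ∀ {i} e → 2 ^ e ≡ suc i → T (isPow2m1 i)
  isPow2m1-complete {i} e 2^e≡1+i =
    any⁺ (λ e → 2 ^ e ≡ᵇ suc i) (applyUpTo⁺ id {n = suc (suc i)} (≡⇒≡ᵇ _ _ 2^e≡1+i) (≤-trans (n<2^n e) (≤-trans (≤-reflexive 2^e≡1+i) (n≤1+n (suc i)))))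

  isPow2m1-sound : ∀ i → T (isPow2m1 i) → ∃ λ e → 2 ^ e ≡ suc i
  isPow2m1-sound i t with applyUpTo⁻ id (any⁻ (λ e → 2 ^ e ≡ᵇ suc i) (upTo (suc (suc i))) t)
  ... | e , _ , found = e , ≡ᵇ⇒≡ _ _ found

  rCoef-power : ∀ {i} e → 2 ^ e ≡ suc i → rCoef i ≡ + 1
  rCoef-power {i} e 2^e≡1+i with isPow2m1 i | isPow2m1-complete e 2^e≡1+i
  ... | true | _ = refl

  rCoef-nonpower : ∀ i → (∀ e → 2 ^ e ≢ suc i) → rCoef i ≡ + 0
  rCoef-nonpower i no-power with isPow2m1 i in isPow
  ... | false = refl
  ... | true  = let e , 2^e≡1+i = isPow2m1-sound i (subst T (sym isPow) _) in ⊥-elim (no-power e 2^e≡1+i)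

  2^-gap : ∀ k e → 2 ^ k < 2 ^ e → 2 ^ e < 2 ^ suc k → ⊥
  2^-gap k e lo hi with e ≤? k
  ... | yes e≤k = <⇒≱ lo (^-monoʳ-≤ 2 e≤k)
  ... | no  e≰k = <⇒≱ hi (^-monoʳ-≤ 2 (≰⇒> e≰k))

  BCoef-2^ : ∀ e → BCoef (2 ^ e) ≡ - + 1
  BCoef-2^ e with 2 ^ e in 2^e≡1+i | m^n>0 2 e
  ... | suc i | _ = cong -_ (rCoef-power e 2^e≡1+i)

  BCoef-between : ∀ k x → 2 ^ k < x → x < 2 ^ suc k → BCoef x ≡ + 0
  BCoef-between k (suc i) lo hi = cong -_ (rCoef-nonpower i λ e 2^e≡1+i →
    2^-gap k e (subst (2 ^ k <_) (sym 2^e≡1+i) lo) (subst (_< 2 ^ suc k) (sym 2^e≡1+i) hi))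

  BCoef-off-pivot : ∀ k J Q y → 0 < Q → Q < J → J + Q ≡ 2 ^ suc k → y ≤ J → y ≢ Q → BCoef (y + J) ≡ + 0
  BCoef-off-pivot k J Q y 0<Q Q<J J+Q≡2^k+1 y≤J y≢Q with <-cmp y Q
  ... | tri≈ _ y≡Q _ = ⊥-elim (y≢Q y≡Q)
  ... | tri< y<Q _ _ = BCoef-between k (y + J) (<-≤-trans 2^k<J (m≤n+m J y)) (begin-strict
    y + J      <⟨ +-monoˡ-< J y<Q ⟩
    Q + J      ≡⟨ +-comm Q J ⟩
    J + Q      ≡⟨ J+Q≡2^k+1 ⟩
    2 ^ suc k  ∎)
    where
    open ≤-Reasoning
    2^k<J : 2 ^ k < J
    2^k<J = *-cancelˡ-< 2 (2 ^ k) J (begin-strict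
      2 ^ suc k  ≡⟨ J+Q≡2^k+1 ⟨
      J + Q      <⟨ +-monoʳ-< J Q<J ⟩
      J + J      ≡⟨ cong (_+_ J) (+-identityʳ J) ⟨
      2 * J      ∎)
  ... | tri> _ _ Q<y = BCoef-between (suc k) (y + J) (begin-strict
    2 ^ suc k  ≡⟨ J+Q≡2^k+1 ⟨
    J + Q      ≡⟨ +-comm J Q ⟩
    Q + J      <⟨ +-monoˡ-< J Q<y ⟩
    y + J      ∎) (begin-strict
    y + J                ≤⟨ +-monoˡ-≤ J y≤J ⟩
    J + J                <⟨ +-monoʳ-< J (m<m+n J 0<Q) ⟩
    J + (J + Q)          ≤⟨ +-monoˡ-≤ (J + Q) (m≤m+n J Q) ⟩
    (J + Q) + (J + Q)    ≡⟨ cong₂ _+_ J+Q≡2^k+1 (trans J+Q≡2^k+1 (sym (+-identityʳ (2 ^ suc k)))) ⟩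
    2 ^ suc (suc k)      ∎)
    where open ≤-Reasoning

module HankelMinors where
  open Sign
  open Determinant
  open Indexing

  open import Defs
  open import Data.Nat as ℕ using (ℕ; zero; suc; _≤_; _<_; z≤n; s≤s)
  open import Data.Nat.Properties as ℕ using (≤-trans; n≤1+n; ≤∧≢⇒<)
  open import Data.Fin using (Fin; zero; suc; toℕ; punchIn; fromℕ; fromℕ<)
  open import Data.Fin.Properties using (toℕ-fromℕ; toℕ-fromℕ<; toℕ<n; toℕ-injective; punchInᵢ≢i; _≟_)
  open import Data.Integer using (ℤ; +_; -_; _+_; _-_; _*_)
  open import Data.Integer.Properties using (*-identityˡ; +-identityˡ; +-identityʳ; +-comm)
  open import Function using (_∘_; id; const)
  open import Data.Vec.Functional using (updateAt)
  open import Data.Vec.Functional.Properties using (updateAt-updates; updateAt-minimal)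
  open import Relation.Nullary using (yes; no)
  open import Relation.Binary.PropositionalEquality
  open ≡-Reasoning

  Hankel : (ℕ → ℤ) → (ℕ → ℕ) → (ℕ → ℕ) → ∀ n → Mat n
  Hankel a ρ κ n i j = a (ρ (toℕ i) ℕ.+ κ (toℕ j))

  det-Hankel-cong : ∀ n a {ρ ρ′ κ κ′ : ℕ → ℕ} →
    (∀ i → i < n → ρ i ≡ ρ′ i) → (∀ j → j < n → κ j ≡ κ′ j) →
    det n (Hankel a ρ κ n) ≡ det n (Hankel a ρ′ κ′ n)
  det-Hankel-cong n a ρ≈ρ′ κ≈κ′ = det-cong n λ i j →
    cong₂ (λ x y → a (x ℕ.+ y)) (ρ≈ρ′ (toℕ i) (toℕ<n i)) (κ≈κ′ (toℕ j) (toℕ<n j))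

  det-minor-Hankel : ∀ n a ρ κ (r c : Fin (suc n)) →
    det n (minor (Hankel a ρ κ (suc n)) r c) ≡ det n (Hankel a (ρ ∘ skip (toℕ r)) (κ ∘ skip (toℕ c)) n)
  det-minor-Hankel n a ρ κ r c = det-cong n λ i j →
    cong₂ (λ x y → a (ρ x ℕ.+ κ y)) (toℕ-punchIn r i) (toℕ-punchIn c j)

  det-Hankel-last-col : ∀ n a ρ κ m → m ≤ n →
    (∀ i → i ≤ n → i ≢ m → a (ρ i ℕ.+ κ n) ≡ + 0) →
    det (suc n) (Hankel a ρ κ (suc n)) ≡ -1^ (m ℕ.+ n) * a (ρ m ℕ.+ κ n) * det n (Hankel a (ρ ∘ skip m) κ n)
  det-Hankel-last-col n a ρ κ m m≤n lone = begin
    det (suc n) M                                         ≡⟨ det-expand-col n M r c column ⟩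
    -1^ (toℕ r ℕ.+ toℕ c) * M r c * det n (minor M r c)  ≡⟨ cong₂ (λ x y → -1^ (x ℕ.+ y) * a (ρ x ℕ.+ κ y) * det n (minor M r c)) r≡m c≡n ⟩
    -1^ (m ℕ.+ n) * a (ρ m ℕ.+ κ n) * det n (minor M r c) ≡⟨ cong (-1^ (m ℕ.+ n) * a (ρ m ℕ.+ κ n) *_) minor≡ ⟩
    -1^ (m ℕ.+ n) * a (ρ m ℕ.+ κ n) * det n (Hankel a (ρ ∘ skip m) κ n) ∎
    where
    M = Hankel a ρ κ (suc n)
    r = fromℕ< (s≤s m≤n)
    c = fromℕ n
    r≡m : toℕ r ≡ m
    r≡m = toℕ-fromℕ< (s≤s m≤n)
    c≡n : toℕ c ≡ n
    c≡n = toℕ-fromℕ n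
    column : ∀ i → M (punchIn r i) c ≡ + 0
    column i = begin
      a (ρ (toℕ (punchIn r i)) ℕ.+ κ (toℕ c)) ≡⟨ cong₂ (λ x y → a (ρ x ℕ.+ κ y)) (trans (toℕ-punchIn r i) (cong (λ x → skip x (toℕ i)) r≡m)) c≡n ⟩
      a (ρ (skip m (toℕ i)) ℕ.+ κ n)          ≡⟨ lone _ (≤-trans (skip-≤ m (toℕ i)) (toℕ<n i)) (skip-≢ m (toℕ i)) ⟩
      + 0                                      ∎
    minor≡ : det n (minor M r c) ≡ det n (Hankel a (ρ ∘ skip m) κ n)
    minor≡ = trans (det-minor-Hankel n a ρ κ r c)
      (det-Hankel-cong n a (λ i _ → cong (λ x → ρ (skip x i)) r≡m)
                           (λ j j<n → cong κ (trans (cong (λ x → skip x j) c≡n) (skip-< j<n))))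

  det-Hankel-last-row : ∀ n a ρ κ m → m ≤ n →
    (∀ j → j ≤ n → j ≢ m → a (ρ n ℕ.+ κ j) ≡ + 0) →
    det (suc n) (Hankel a ρ κ (suc n)) ≡ -1^ (n ℕ.+ m) * a (ρ n ℕ.+ κ m) * det n (Hankel a ρ (κ ∘ skip m) n)
  det-Hankel-last-row n a ρ κ m m≤n lone = begin
    det (suc n) M                                         ≡⟨ det-expand-row n M r c row ⟩
    -1^ (toℕ r ℕ.+ toℕ c) * M r c * det n (minor M r c)  ≡⟨ cong₂ (λ x y → -1^ (x ℕ.+ y) * a (ρ x ℕ.+ κ y) * det n (minor M r c)) r≡n c≡m ⟩
    -1^ (n ℕ.+ m) * a (ρ n ℕ.+ κ m) * det n (minor M r c) ≡⟨ cong (-1^ (n ℕ.+ m) * a (ρ n ℕ.+ κ m) *_) minor≡ ⟩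
    -1^ (n ℕ.+ m) * a (ρ n ℕ.+ κ m) * det n (Hankel a ρ (κ ∘ skip m) n) ∎
    where
    M = Hankel a ρ κ (suc n)
    r = fromℕ n
    c = fromℕ< (s≤s m≤n)
    r≡n : toℕ r ≡ n
    r≡n = toℕ-fromℕ n
    c≡m : toℕ c ≡ m
    c≡m = toℕ-fromℕ< (s≤s m≤n)
    row : ∀ j → M r (punchIn c j) ≡ + 0
    row j = begin
      a (ρ (toℕ r) ℕ.+ κ (toℕ (punchIn c j))) ≡⟨ cong₂ (λ x y → a (ρ x ℕ.+ κ y)) r≡n (trans (toℕ-punchIn c j) (cong (λ x → skip x (toℕ j)) c≡m)) ⟩
      a (ρ n ℕ.+ κ (skip m (toℕ j)))          ≡⟨ lone _ (≤-trans (skip-≤ m (toℕ j)) (toℕ<n j)) (skip-≢ m (toℕ j)) ⟩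
      + 0                                      ∎
    minor≡ : det n (minor M r c) ≡ det n (Hankel a ρ (κ ∘ skip m) n)
    minor≡ = trans (det-minor-Hankel n a ρ κ r c)
      (det-Hankel-cong n a (λ i i<n → cong ρ (trans (cong (λ x → skip x i) r≡n) (skip-< i<n)))
                           (λ j _ → cong (λ x → κ (skip x j)) c≡m))

  det-Hankel-peel : ∀ p a ρ m → m ≤ p →
    (∀ i → i ≤ suc p → i ≢ m → a (ρ i ℕ.+ ρ (suc p)) ≡ + 0) →
    det (suc (suc p)) (Hankel a ρ ρ (suc (suc p))) ≡
      - (a (ρ m ℕ.+ ρ (suc p)) * a (ρ (suc p) ℕ.+ ρ m) * det p (Hankel a (ρ ∘ skip m) (ρ ∘ skip m) p))
  det-Hankel-peel p a ρ m m≤p lone = begin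
    det (suc (suc p)) (Hankel a ρ ρ (suc (suc p)))
      ≡⟨ det-Hankel-last-col (suc p) a ρ ρ m (≤-trans m≤p (n≤1+n p)) lone ⟩
    -1^ (m ℕ.+ suc p) * e * det (suc p) (Hankel a (ρ ∘ skip m) ρ (suc p))
      ≡⟨ cong (-1^ (m ℕ.+ suc p) * e *_) (det-Hankel-last-row p a (ρ ∘ skip m) ρ m m≤p row) ⟩
    -1^ (m ℕ.+ suc p) * e * (-1^ (p ℕ.+ m) * a (ρ (skip m p) ℕ.+ ρ m) * D)
      ≡⟨ cong (λ x → -1^ (m ℕ.+ suc p) * e * (-1^ (p ℕ.+ m) * a (ρ x ℕ.+ ρ m) * D)) (skip-≥ m≤p) ⟩
    -1^ (m ℕ.+ suc p) * e * (-1^ (p ℕ.+ m) * e′ * D)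
      ≡⟨ cong₂ (λ x y → -1^ x * e * (-1^ y * e′ * D)) (ℕ.+-suc m p) (ℕ.+-comm p m) ⟩
    -1^ (suc (m ℕ.+ p)) * e * (-1^ (m ℕ.+ p) * e′ * D)
      ≡⟨ -1^-suc-cancel (m ℕ.+ p) e e′ D ⟩
    - (e * e′ * D) ∎
    where
    e = a (ρ m ℕ.+ ρ (suc p))
    e′ = a (ρ (suc p) ℕ.+ ρ m)
    D = det p (Hankel a (ρ ∘ skip m) (ρ ∘ skip m) p)
    row : ∀ j → j ≤ p → j ≢ m → a (ρ (skip m p) ℕ.+ ρ j) ≡ + 0
    row j j≤p j≢m = begin
      a (ρ (skip m p) ℕ.+ ρ j)  ≡⟨ cong (λ x → a (ρ x ℕ.+ ρ j)) (skip-≥ m≤p) ⟩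
      a (ρ (suc p) ℕ.+ ρ j)     ≡⟨ cong a (ℕ.+-comm (ρ (suc p)) (ρ j)) ⟩
      a (ρ j ℕ.+ ρ (suc p))     ≡⟨ lone j (≤-trans j≤p (n≤1+n p)) j≢m ⟩
      + 0                        ∎

  -- Rows and columns 0, …, m′, c: the last row is (a c, 0, …, 0, a (c + c)), which is split by linearity.
  module BorderedHankel (m′ : ℕ) (a : ℕ → ℤ) (ρ : ℕ → ℕ) (c : ℕ)
    (ρ-id : ∀ i → i < suc m′ → ρ i ≡ i) (ρ-last : ρ (suc m′) ≡ c)
    (gap : ∀ j → 0 < j → j < suc m′ → a (c ℕ.+ j) ≡ + 0) where

    private
      m = suc m′
      M = Hankel a ρ ρ (suc m)
      last = fromℕ m

      ρ-toℕ-last : ρ (toℕ last) ≡ c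
      ρ-toℕ-last = trans (cong ρ (toℕ-fromℕ m)) ρ-last

      u : Fin (suc m) → ℤ
      u zero    = a c
      u (suc _) = + 0

      v : Fin (suc m) → ℤ
      v = updateAt (const (+ 0)) last (const (a (c ℕ.+ c)))

      last-row-split : ∀ j → M last j ≡ u j + v j
      last-row-split j with j ≟ last
      ... | yes refl = begin
        a (ρ (toℕ last) ℕ.+ ρ (toℕ last))  ≡⟨ cong (λ x → a (x ℕ.+ x)) ρ-toℕ-last ⟩
        a (c ℕ.+ c)                         ≡⟨ updateAt-updates last (const (+ 0)) ⟨
        v last                              ≡⟨ +-identityˡ (v last) ⟨
        u last + v last                     ∎
      ... | no j≢last = begin
        M last j       ≡⟨ off-corner j (≤∧≢⇒< (ℕ.≤-pred (toℕ<n j)) (j≢last ∘ toℕ≡m)) ⟩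
        u j            ≡⟨ +-identityʳ (u j) ⟨
        u j + + 0      ≡⟨ cong (_+_ (u j)) (updateAt-minimal j last (const (+ 0)) j≢last) ⟨
        u j + v j      ∎
        where
        toℕ≡m : toℕ j ≡ m → j ≡ last
        toℕ≡m eq = toℕ-injective (trans eq (sym (toℕ-fromℕ m)))
        off-corner : ∀ j → toℕ j < m → M last j ≡ u j
        off-corner zero    _   = cong a (trans (cong₂ ℕ._+_ ρ-toℕ-last (ρ-id 0 (s≤s z≤n))) (ℕ.+-identityʳ c))
        off-corner (suc j) j<m = trans (cong₂ (λ x y → a (x ℕ.+ y)) ρ-toℕ-last (ρ-id _ j<m)) (gap _ (s≤s z≤n) j<m)

      ρ-skip-last : ∀ i → i < m → ρ (skip (toℕ last) i) ≡ i
      ρ-skip-last i i<m = trans (cong ρ (trans (cong (λ x → skip x i) (toℕ-fromℕ m)) (skip-< i<m))) (ρ-id i i<m)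

      det-last-row-v : det (suc m) (updateAt M last (const v)) ≡ a (c ℕ.+ c) * H m a
      det-last-row-v = begin
        det (suc m) M₂
          ≡⟨ det-expand-row m M₂ last last row ⟩
        -1^ (toℕ last ℕ.+ toℕ last) * M₂ last last * det m (minor M₂ last last)
          ≡⟨ cong (λ x → x * M₂ last last * det m (minor M₂ last last)) (-1^-double (toℕ last)) ⟩
        + 1 * M₂ last last * det m (minor M₂ last last)
          ≡⟨ cong₂ (λ x y → + 1 * x * y) corner minor≡ ⟩
        + 1 * a (c ℕ.+ c) * H m a
          ≡⟨ cong (_* H m a) (*-identityˡ (a (c ℕ.+ c))) ⟩
        a (c ℕ.+ c) * H m a ∎
        where
        M₂ = updateAt M last (const v)
        row : ∀ j → M₂ last (punchIn last j) ≡ + 0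
        row j = trans (cong (λ row → row (punchIn last j)) (updateAt-updates last M))
                      (updateAt-minimal (punchIn last j) last (const (+ 0)) (punchInᵢ≢i last j))
        corner : M₂ last last ≡ a (c ℕ.+ c)
        corner = trans (cong (λ row → row last) (updateAt-updates last M)) (updateAt-updates last (const (+ 0)))
        minor≡ : det m (minor M₂ last last) ≡ H m a
        minor≡ = begin
          det m (minor M₂ last last)  ≡⟨ det-minor-updateAt m M last (const v) last ⟩
          det m (minor M last last)   ≡⟨ det-minor-Hankel m a ρ ρ last last ⟩
          det m (Hankel a (ρ ∘ skip (toℕ last)) (ρ ∘ skip (toℕ last)) m) ≡⟨ det-Hankel-cong m a ρ-skip-last ρ-skip-last ⟩
          H m a ∎

      det-last-row-u : det (suc m) (updateAt M last (const u)) ≡ - (a c * a c * H m′ (λ i → a (2 ℕ.+ i)))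
      det-last-row-u = begin
        det (suc m) M₁
          ≡⟨ det-expand-row m M₁ last zero row ⟩
        -1^ (toℕ last ℕ.+ 0) * M₁ last zero * det m (minor M₁ last zero)
          ≡⟨ cong₂ (λ x y → -1^ x * y * det m (minor M₁ last zero)) (trans (ℕ.+-identityʳ (toℕ last)) (toℕ-fromℕ m)) corner ⟩
        -1^ m * a c * det m (minor M₁ last zero)
          ≡⟨ cong (-1^ m * a c *_) minor≡ ⟩
        -1^ m * a c * (-1^ m′ * a c * H m′ (λ i → a (2 ℕ.+ i)))
          ≡⟨ -1^-suc-cancel m′ (a c) (a c) (H m′ (λ i → a (2 ℕ.+ i))) ⟩
        - (a c * a c * H m′ (λ i → a (2 ℕ.+ i))) ∎
        where
        M₁ = updateAt M last (const u)
        row : ∀ j → M₁ last (punchIn zero j) ≡ + 0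
        row j = cong (λ row → row (suc j)) (updateAt-updates last M)
        corner : M₁ last zero ≡ a c
        corner = cong (λ row → row zero) (updateAt-updates last M)
        lone : ∀ i → i ≤ m′ → i ≢ 0 → a (i ℕ.+ ρ (suc m′)) ≡ + 0
        lone i i≤m′ i≢0 = trans (cong a (trans (cong (i ℕ.+_) ρ-last) (ℕ.+-comm i c))) (gap i (ℕ.n≢0⇒n>0 i≢0) (s≤s i≤m′))
        shifted : det m′ (Hankel a suc (ρ ∘ suc) m′) ≡ H m′ (λ i → a (2 ℕ.+ i))
        shifted = det-cong m′ λ i j → cong a (trans (cong (suc (toℕ i) ℕ.+_) (ρ-id (suc (toℕ j)) (s≤s (toℕ<n j))))
                                                     (cong suc (ℕ.+-suc (toℕ i) (toℕ j))))
        minor≡ : det m (minor M₁ last zero) ≡ -1^ m′ * a c * H m′ (λ i → a (2 ℕ.+ i))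
        minor≡ = begin
          det m (minor M₁ last zero)                   ≡⟨ det-minor-updateAt m M last (const u) zero ⟩
          det m (minor M last zero)                    ≡⟨ det-minor-Hankel m a ρ ρ last zero ⟩
          det m (Hankel a (ρ ∘ skip (toℕ last)) (ρ ∘ suc) m) ≡⟨ det-Hankel-cong m a {κ′ = ρ ∘ suc} ρ-skip-last (λ _ _ → refl) ⟩
          det m (Hankel a id (ρ ∘ suc) m)              ≡⟨ det-Hankel-last-col m′ a id (ρ ∘ suc) 0 z≤n lone ⟩
          -1^ m′ * a (ρ (suc m′)) * det m′ (Hankel a suc (ρ ∘ suc) m′) ≡⟨ cong₂ (λ x y → -1^ m′ * a x * y) ρ-last shifted ⟩
          -1^ m′ * a c * H m′ (λ i → a (2 ℕ.+ i))       ∎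

    det-bordered : det (suc (suc m′)) (Hankel a ρ ρ (suc (suc m′))) ≡
      a (c ℕ.+ c) * H (suc m′) a - a c * a c * H m′ (λ i → a (2 ℕ.+ i))
    det-bordered = begin
      det (suc m) M  ≡⟨ det-updateAt-row-+ m M last u v last-row-split ⟩
      det (suc m) (updateAt M last (const u)) + det (suc m) (updateAt M last (const v))
        ≡⟨ cong₂ _+_ det-last-row-u det-last-row-v ⟩
      - (a c * a c * H m′ (λ i → a (2 ℕ.+ i))) + a (c ℕ.+ c) * H m a
        ≡⟨ +-comm (- (a c * a c * H m′ (λ i → a (2 ℕ.+ i)))) (a (c ℕ.+ c) * H m a) ⟩
      a (c ℕ.+ c) * H m a - a c * a c * H m′ (λ i → a (2 ℕ.+ i)) ∎

open import Defs
open import Data.Nat as ℕ using (ℕ; zero; suc; _≤_; _<_; z≤n; s≤s; _∸_)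
open import Data.Nat.Properties as ℕ using (≤-refl; ≤-trans; n≤1+n; m≤n+m; m≤m+n; m<m+n; <-≤-trans; +-monoˡ-≤)
open import Data.Nat.Tactic.RingSolver as ℕ-Solver using ()
open import Data.Integer using (ℤ; +_; -_; _+_; _-_; _*_; _^_)
open import Data.Integer.Properties using (*-identityˡ; neg-distribˡ-*; neg-distribʳ-*; -1*i≡-i; ^-distribˡ-+-*)
open import Data.Integer.Tactic.RingSolver using (solve-∀)
open import Data.Product using (_×_; _,_)
open import Function using (_∘_)
open import Data.Empty using (⊥-elim)
open import Relation.Binary.PropositionalEquality hiding (J)
open ≡-Reasoning

open Sign
open Determinant
open Indexing
open PowersOfTwo
open HankelMinors

det-BCoef-peel : ∀ K m l p → 0 < m → m ≤ p → suc p ℕ.+ l ℕ.+ (m ℕ.+ l) ≡ 2 ℕ.^ suc K →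
  det (suc (suc p)) (Hankel BCoef (skipBlock m l) (skipBlock m l) (suc (suc p))) ≡
    - det p (Hankel BCoef (skipBlock m (suc l)) (skipBlock m (suc l)) p)
det-BCoef-peel K m l p 0<m m≤p J+Q≡2^K+1 = begin
  det (suc (suc p)) (Hankel BCoef ρ ρ (suc (suc p)))
    ≡⟨ det-Hankel-peel p BCoef ρ m m≤p lone ⟩
  - (BCoef (ρ m ℕ.+ ρ (suc p)) * BCoef (ρ (suc p) ℕ.+ ρ m) * D)
    ≡⟨ cong₂ (λ x y → - (x * y * D)) pivot (trans (cong BCoef (ℕ.+-comm (ρ (suc p)) (ρ m))) pivot) ⟩
  - (- + 1 * - + 1 * D)
    ≡⟨ cong -_ (*-identityˡ D) ⟩
  - D
    ≡⟨ cong -_ (det-Hankel-cong p BCoef (λ i _ → skipBlock-skip m l i) (λ j _ → skipBlock-skip m l j)) ⟩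
  - det p (Hankel BCoef (skipBlock m (suc l)) (skipBlock m (suc l)) p) ∎
  where
  ρ = skipBlock m l
  D = det p (Hankel BCoef (ρ ∘ skip m) (ρ ∘ skip m) p)
  J = suc p ℕ.+ l
  Q = m ℕ.+ l
  ρm≡Q : ρ m ≡ Q
  ρm≡Q = skipBlock-≥ l ≤-refl
  ρ1+p≡J : ρ (suc p) ≡ J
  ρ1+p≡J = skipBlock-≥ l (≤-trans m≤p (n≤1+n p))
  pivot : BCoef (ρ m ℕ.+ ρ (suc p)) ≡ - + 1
  pivot = trans (cong BCoef (trans (cong₂ ℕ._+_ ρm≡Q ρ1+p≡J) (trans (ℕ.+-comm Q J) J+Q≡2^K+1))) (BCoef-2^ (suc K))
  lone : ∀ i → i ≤ suc p → i ≢ m → BCoef (ρ i ℕ.+ ρ (suc p)) ≡ + 0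
  lone i i≤1+p i≢m = trans (cong (λ x → BCoef (ρ i ℕ.+ x)) ρ1+p≡J)
    (BCoef-off-pivot K J Q (ρ i) (<-≤-trans 0<m (m≤m+n m l)) (ℕ.+-monoˡ-< l (s≤s m≤p)) J+Q≡2^K+1
      (≤-trans (skipBlock-≤ m l i) (+-monoˡ-≤ l i≤1+p))
      (λ ρi≡Q → i≢m (skipBlock-injective m l (trans ρi≡Q (sym ρm≡Q)))))

det-BCoef-peel-iterate : ∀ K m t l → 0 < m → m ℕ.+ l ℕ.+ t ≡ 2 ℕ.^ K →
  det (t ℕ.* 2 ℕ.+ suc m) (Hankel BCoef (skipBlock m l) (skipBlock m l) (t ℕ.* 2 ℕ.+ suc m)) ≡
    -1^ t * det (suc m) (Hankel BCoef (skipBlock m (l ℕ.+ t)) (skipBlock m (l ℕ.+ t)) (suc m))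
det-BCoef-peel-iterate K m zero l 0<m _ rewrite ℕ.+-identityʳ l = sym (*-identityˡ _)
det-BCoef-peel-iterate K m (suc t) l 0<m m+l+t≡2^K = begin
  det (suc (suc p)) (Hankel BCoef (skipBlock m l) (skipBlock m l) (suc (suc p)))
    ≡⟨ det-BCoef-peel K m l p 0<m (≤-trans (n≤1+n m) (m≤n+m (suc m) (t ℕ.* 2))) J+Q≡2^K+1 ⟩
  - det p (Hankel BCoef (skipBlock m (suc l)) (skipBlock m (suc l)) p)
    ≡⟨ cong -_ (det-BCoef-peel-iterate K m t (suc l) 0<m (trans (shift m l t) m+l+t≡2^K)) ⟩
  - (-1^ t * D (suc l ℕ.+ t))
    ≡⟨ neg-distribˡ-* (-1^ t) (D (suc l ℕ.+ t)) ⟩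
  - -1^ t * D (suc l ℕ.+ t)
    ≡⟨ cong₂ _*_ (sym (-1*i≡-i (-1^ t))) (cong D (sym (ℕ.+-suc l t))) ⟩
  -1^ suc t * D (l ℕ.+ suc t) ∎
  where
  p = t ℕ.* 2 ℕ.+ suc m
  D : ℕ → ℤ
  D l′ = det (suc m) (Hankel BCoef (skipBlock m l′) (skipBlock m l′) (suc m))
  shift : ∀ m l t → m ℕ.+ suc l ℕ.+ t ≡ m ℕ.+ l ℕ.+ suc t
  shift = ℕ-Solver.solve-∀
  double : ∀ m l t → suc (t ℕ.* 2 ℕ.+ suc m) ℕ.+ l ℕ.+ (m ℕ.+ l) ≡ (m ℕ.+ l ℕ.+ suc t) ℕ.+ ((m ℕ.+ l ℕ.+ suc t) ℕ.+ 0)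
  double = ℕ-Solver.solve-∀
  J+Q≡2^K+1 : suc p ℕ.+ l ℕ.+ (m ℕ.+ l) ≡ 2 ℕ.^ suc K
  J+Q≡2^K+1 = trans (double m l t) (cong (λ x → x ℕ.+ (x ℕ.+ 0)) m+l+t≡2^K)

det-BCoef-bordered : ∀ K m′ l → suc m′ ℕ.+ l ≡ 2 ℕ.^ K →
  det (suc (suc m′)) (Hankel BCoef (skipBlock (suc m′) l) (skipBlock (suc m′) l) (suc (suc m′))) ≡ - (h (suc m′) + g m′)
det-BCoef-bordered K m′ l m+l≡2^K = begin
  det (suc (suc m′)) (Hankel BCoef ρ ρ (suc (suc m′)))
    ≡⟨ BorderedHankel.det-bordered m′ BCoef ρ c (λ i → skipBlock-< l) (trans (skipBlock-≥ l ≤-refl) m+l≡2^K) gap ⟩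
  BCoef (c ℕ.+ c) * h (suc m′) - BCoef c * BCoef c * g m′
    ≡⟨ cong₂ (λ x y → x * h (suc m′) - y * y * g m′) (trans (cong BCoef c+c≡2^K+1) (BCoef-2^ (suc K))) (BCoef-2^ K) ⟩
  - + 1 * h (suc m′) - - + 1 * - + 1 * g m′
    ≡⟨ simplify (h (suc m′)) (g m′) ⟩
  - (h (suc m′) + g m′) ∎
  where
  ρ = skipBlock (suc m′) l
  c = 2 ℕ.^ K
  c+c≡2^K+1 : c ℕ.+ c ≡ 2 ℕ.^ suc K
  c+c≡2^K+1 = cong (c ℕ.+_) (sym (ℕ.+-identityʳ c))
  gap : ∀ j → 0 < j → j < suc m′ → BCoef (c ℕ.+ j) ≡ + 0
  gap j 0<j j<m = BCoef-between K (c ℕ.+ j) (m<m+n c 0<j)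
    (subst (c ℕ.+ j <_) c+c≡2^K+1 (ℕ.+-monoʳ-< c (<-≤-trans j<m (subst (suc m′ ≤_) m+l≡2^K (m≤m+n (suc m′) l)))))
  simplify : ∀ x y → - + 1 * x - - + 1 * - + 1 * y ≡ - (x + y)
  simplify = solve-∀

h-recurrence : ∀ K m′ t → suc m′ ℕ.+ t ≡ 2 ℕ.^ suc K →
  h (t ℕ.* 2 ℕ.+ suc (suc m′)) ≡ -1^ (t ℕ.* 2 ℕ.+ suc (suc m′)) * (h (suc m′) + g m′)
h-recurrence K m′ t m+t≡2^K+1 = begin
  h n
    ≡⟨ det-Hankel-cong n BCoef (λ i _ → sym (skipBlock-zero m i)) (λ j _ → sym (skipBlock-zero m j)) ⟩
  det n (Hankel BCoef (skipBlock m 0) (skipBlock m 0) n)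
    ≡⟨ det-BCoef-peel-iterate (suc K) m t 0 (s≤s z≤n) (trans (cong (ℕ._+ t) (ℕ.+-identityʳ m)) m+t≡2^K+1) ⟩
  -1^ t * det (suc m) (Hankel BCoef (skipBlock m t) (skipBlock m t) (suc m))
    ≡⟨ cong (-1^ t *_) (det-BCoef-bordered (suc K) m′ t m+t≡2^K+1) ⟩
  -1^ t * - X
    ≡⟨ neg-distribʳ-* (-1^ t) X ⟨
  - (-1^ t * X)
    ≡⟨ neg-distribˡ-* (-1^ t) X ⟩
  - -1^ t * X
    ≡⟨ cong (_* X) sign ⟩
  -1^ n * X ∎
  where
  m = suc m′
  n = t ℕ.* 2 ℕ.+ suc m
  X = h m + g m′
  sign : - -1^ t ≡ -1^ n
  sign = begin
    - -1^ t                    ≡⟨ cong -_ (-1^-same-parity m t (2 ℕ.^ K) (trans m+t≡2^K+1 (ℕ.*-comm 2 (2 ℕ.^ K)))) ⟨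
    - -1^ m                    ≡⟨ -1*i≡-i (-1^ m) ⟨
    -1^ suc m                  ≡⟨ *-identityˡ (-1^ suc m) ⟨
    + 1 * -1^ suc m            ≡⟨ cong (_* -1^ suc m) (-1^-even t) ⟨
    -1^ (t ℕ.* 2) * -1^ suc m  ≡⟨ ^-distribˡ-+-* (- + 1) (t ℕ.* 2) (suc m) ⟨
    -1^ n                      ∎

dyadic-split : ∀ n k → 2 ℕ.^ k < n → n ≤ 2 ℕ.^ suc k →
  let m′ = 2 ℕ.^ suc k ∸ n; t = n ∸ suc (2 ℕ.^ k) in
  (suc m′ ℕ.+ t ≡ 2 ℕ.^ k) × (n ≡ t ℕ.* 2 ℕ.+ suc (suc m′))
dyadic-split n k 2^k<n n≤2^k+1 = m+t≡c , n≡2t+m+1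
  where
  c = 2 ℕ.^ k
  m′ = 2 ℕ.^ suc k ∸ n
  t = n ∸ suc c
  t+1+c≡n : t ℕ.+ suc c ≡ n
  t+1+c≡n = ℕ.m∸n+n≡m 2^k<n
  regroup : ∀ m′ t c → suc m′ ℕ.+ t ℕ.+ c ≡ m′ ℕ.+ (t ℕ.+ suc c)
  regroup = ℕ-Solver.solve-∀
  m+t≡c : suc m′ ℕ.+ t ≡ c
  m+t≡c = ℕ.+-cancelʳ-≡ c (suc m′ ℕ.+ t) c (begin
    suc m′ ℕ.+ t ℕ.+ c    ≡⟨ regroup m′ t c ⟩
    m′ ℕ.+ (t ℕ.+ suc c)  ≡⟨ cong (m′ ℕ.+_) t+1+c≡n ⟩
    m′ ℕ.+ n              ≡⟨ ℕ.m∸n+n≡m n≤2^k+1 ⟩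
    c ℕ.+ (c ℕ.+ 0)       ≡⟨ cong (c ℕ.+_) (ℕ.+-identityʳ c) ⟩
    c ℕ.+ c               ∎)
  unfold : ∀ m′ t → t ℕ.+ suc (suc m′ ℕ.+ t) ≡ t ℕ.* 2 ℕ.+ suc (suc m′)
  unfold = ℕ-Solver.solve-∀
  n≡2t+m+1 : n ≡ t ℕ.* 2 ℕ.+ suc (suc m′)
  n≡2t+m+1 = begin
    n                          ≡⟨ t+1+c≡n ⟨
    t ℕ.+ suc c                ≡⟨ cong (λ x → t ℕ.+ suc x) m+t≡c ⟨
    t ℕ.+ suc (suc m′ ℕ.+ t)   ≡⟨ unfold m′ t ⟩
    t ℕ.* 2 ℕ.+ suc (suc m′)   ∎

theorem19 : (h 0 ≡ + 1) × (h 1 ≡ + 1) × (h 2 ≡ - (+ 2))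
    × ((n k : ℕ) → 3 ≤ n → 2 ℕ.^ k < n → n ≤ 2 ℕ.^ suc k
    → h n ≡ ((- + 1) ^ n) * (h (2 ℕ.^ suc k ∸ n ℕ.+ 1) + g (2 ℕ.^ suc k ∸ n)))
theorem19 = refl , refl , refl , dyadic-recurrence
  where
  dyadic-recurrence : (n k : ℕ) → 3 ≤ n → 2 ℕ.^ k < n → n ≤ 2 ℕ.^ suc k →
    h n ≡ -1^ n * (h (2 ℕ.^ suc k ∸ n ℕ.+ 1) + g (2 ℕ.^ suc k ∸ n))
  dyadic-recurrence n zero    3≤n _ n≤2 = ⊥-elim (ℕ.<-irrefl refl (≤-trans 3≤n n≤2))
  dyadic-recurrence n (suc K) _ 2^k<n n≤2^k+1
    with m+t≡2^k , n≡2t+m+1 ← dyadic-split n (suc K) 2^k<n n≤2^k+1 = begin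
    h n                                   ≡⟨ cong h n≡2t+m+1 ⟩
    h (t ℕ.* 2 ℕ.+ suc (suc m′))          ≡⟨ h-recurrence K m′ t m+t≡2^k ⟩
    -1^ (t ℕ.* 2 ℕ.+ suc (suc m′)) * (h (suc m′) + g m′)
      ≡⟨ cong₂ (λ x y → -1^ x * (h y + g m′)) (sym n≡2t+m+1) (ℕ.+-comm 1 m′) ⟩
    -1^ n * (h (m′ ℕ.+ 1) + g m′)         ∎
    where
    m′ = 2 ℕ.^ suc (suc K) ∸ n
    t = n ∸ suc (2 ℕ.^ suc K)
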